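{- If $G$ and $H$ are connected graphs and $S$ is a general position set of the lexicographic product $G\circ H$, then $\pi_G(S)$ is a general position set of $G$.
   Context: A general position set of a graph $G$ is a set $S\subseteq V(G)$ such that no three vertices of $S$ lie on a common shortest path of $G$. The lexicographic product $G\circ H$ has vertex set $V(G)\times V(H)$, with $(g,h)$ adjacent to $(g',h')$ iff either $gg'\in E(G)$, or $g=g'$ and $hh'\in E(H)$. For $S\subseteq V(G\circ H)$, $\pi_G(S)=\{g\in V(G): (g,h)\in S \text{ for some } h\in V(H)\}$. -}

module Defs where

open import Level using (0ℓ)
open import Data.Nat using (ℕ; zero; suc; _≤_)
open import Data.Fin using (Fin)
open import Data.Product using (Σ; ∃; _×_; _,_; proj₁; proj₂)
open import Data.Sum using (_⊎_; inj₁; inj₂)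
open import Data.Empty using (⊥)
open import Function.Bundles using (_↔_)
open import Relation.Nullary using (¬_)
open import Relation.Binary.PropositionalEquality using (_≡_; refl; sym)

record Graph : Set₁ where
  field
    V      : Set
    E      : V → V → Set
    E-sym  : ∀ {x y} → E x y → E y x
    E-irr  : ∀ {x} → ¬ E x x
open Graph public

Finite : Graph → Set
Finite G = Σ ℕ λ n → V G ↔ Fin n

data Walk (G : Graph) : V G → V G → ℕ → Set where
  []  : ∀ {x} → Walk G x x zero
  _∷_ : ∀ {x y z k} → E G x y → Walk G y z k → Walk G x z (suc k)

Connected : Graph → Set
Connected G = ∀ (x y : V G) → Σ ℕ λ k → Walk G x y k

data _∈W_ {G : Graph} (v : V G) : ∀ {x y k} → Walk G x y k → Set where
  here  : ∀ {y k} {w : Walk G v y k} → v ∈W w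
  there : ∀ {x y z k} {e : E G x y} {w : Walk G y z k} → v ∈W w → v ∈W (e ∷ w)
  last  : v ∈W ([] {G} {v})

IsShortest : ∀ {G : Graph} {x y k} → Walk G x y k → Set
IsShortest {G} {x} {y} {k} _ = ∀ {k'} → Walk G x y k' → k ≤ k'

OnCommonShortestPath : (G : Graph) → V G → V G → V G → Set
OnCommonShortestPath G a b c =
  Σ (V G) λ x → Σ (V G) λ y → Σ ℕ λ k → Σ (Walk G x y k) λ w →
    IsShortest w × a ∈W w × b ∈W w × c ∈W w

Subset : Graph → Set₁
Subset G = V G → Set

IsGeneralPosition : (G : Graph) → Subset G → Set
IsGeneralPosition G S =
  ∀ a b c → S a → S b → S c → ¬ a ≡ b → ¬ a ≡ c → ¬ b ≡ c →
    ¬ OnCommonShortestPath G a b c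

LexE : (G H : Graph) → V G × V H → V G × V H → Set
LexE G H (g , h) (g' , h') = E G g g' ⊎ (g ≡ g' × E H h h')

lex : Graph → Graph → Graph
lex G H = record
  { V = V G × V H
  ; E = LexE G H
  ; E-sym = λ { (inj₁ e) → inj₁ (E-sym G e) ; (inj₂ (refl , e)) → inj₂ (refl , E-sym H e) }
  ; E-irr = λ { (inj₁ e) → E-irr G e ; (inj₂ (_ , e)) → E-irr H e }
  }

πG : (G H : Graph) → Subset (lex G H) → Subset G
πG G H S g = Σ (V H) λ h → S (g , h)

{-# OPTIONS --safe #-}
-- A shortest path of G through a, b and c lifts, along any section
-- g ↦ (g , f g), to a walk of G ∘ H of the same length through
-- (a , f a), (b , f b), (c , f c).  It is again shortest, since projecting
-- a walk of G ∘ H to G never makes it longer.  Choosing f with f a = hₐ,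
-- f b = h_b and f c = h_c turns three points of π_G(S) on a common
-- geodesic of G into three points of S on a common geodesic of G ∘ H.
module Submission where

open import Defs
open import Data.Nat using (ℕ; _≤_; z≤n; s≤s)
open import Data.Nat.Properties using (≤-trans; m≤n⇒m≤1+n)
open import Data.Fin.Properties using (inj⇒≟)
open import Data.Product using (Σ-syntax; _×_; _,_; proj₁)
open import Data.Sum using (inj₁; inj₂)
open import Function using (_∘_; const)
open import Function.Properties.Inverse using (↔⇒↣)
open import Relation.Binary.Definitions using (DecidableEquality)
open import Relation.Binary.PropositionalEquality using (_≡_; _≢_; refl; cong; trans; ≢-sym)
open import Relation.Nullary using (yes; no; contradiction)

finite⇒decidableEquality : (G : Graph) → Finite G → DecidableEquality (V G)
finite⇒decidableEquality G (_ , V↔Fin) = inj⇒≟ (↔⇒↣ V↔Fin)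

module _ {A B : Set} (_≟_ : DecidableEquality A) where

  update : A → B → (A → B) → A → B
  update a b f x with x ≟ a
  ... | yes _ = b
  ... | no _  = f x

  update-≡ : ∀ a b f → update a b f a ≡ b
  update-≡ a b f with a ≟ a
  ... | yes _   = refl
  ... | no a≢a = contradiction refl a≢a

  update-≢ : ∀ {a x} b f → x ≢ a → update a b f x ≡ f x
  update-≢ {a} {x} b f x≢a with x ≟ a
  ... | yes x≡a = contradiction x≡a x≢a
  ... | no _    = refl

module _ (G H : Graph) where

  lift-walk : (f : V G → V H) → ∀ {x y k} → Walk G x y k →
    Walk (lex G H) (x , f x) (y , f y) k
  lift-walk f []      = []
  lift-walk f (e ∷ w) = inj₁ e ∷ lift-walk f w

  ∈W-lift : (f : V G → V H) → ∀ {v h x y k} {w : Walk G x y k} → f v ≡ h →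
    v ∈W w → _∈W_ {lex G H} (v , h) (lift-walk f w)
  ∈W-lift f refl here      = here
  ∈W-lift f refl (there m) = there (∈W-lift f refl m)
  ∈W-lift f refl last      = last

  project-walk : ∀ {p q k} → Walk (lex G H) p q k →
    Σ[ k′ ∈ ℕ ] k′ ≤ k × Walk G (proj₁ p) (proj₁ q) k′
  project-walk [] = _ , z≤n , []
  project-walk (inj₁ e ∷ w) with project-walk w
  ... | _ , k′≤k , w′ = _ , s≤s k′≤k , e ∷ w′
  project-walk (inj₂ (refl , _) ∷ w) with project-walk w
  ... | _ , k′≤k , w′ = _ , m≤n⇒m≤1+n k′≤k , w′

  lift-isShortest : (f : V G → V H) → ∀ {x y k} (w : Walk G x y k) →
    IsShortest w → IsShortest {lex G H} (lift-walk f w)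
  lift-isShortest f _ w-shortest w″ with project-walk w″
  ... | _ , k′≤k″ , w′ = ≤-trans (w-shortest w′) k′≤k″

  lift-onCommonShortestPath : (f : V G → V H) → ∀ {a b c ha hb hc} →
    f a ≡ ha → f b ≡ hb → f c ≡ hc → OnCommonShortestPath G a b c →
    OnCommonShortestPath (lex G H) (a , ha) (b , hb) (c , hc)
  lift-onCommonShortestPath f fa fb fc (x , y , k , w , w-shortest , a∈w , b∈w , c∈w) =
    (x , f x) , (y , f y) , k , lift-walk f w , lift-isShortest f w w-shortest ,
    ∈W-lift f fa a∈w , ∈W-lift f fb b∈w , ∈W-lift f fc c∈w

lemma4p2 : (G H : Graph) → Finite G → Finite H → Connected G → Connected H →
    (S : Subset (lex G H)) → IsGeneralPosition (lex G H) S →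
    IsGeneralPosition G (πG G H S)
lemma4p2 G H finG _ _ _ _ S-gp a b c (ha , Sa) (hb , Sb) (hc , Sc) a≢b a≢c b≢c onPath =
  S-gp _ _ _ Sa Sb Sc (a≢b ∘ cong proj₁) (a≢c ∘ cong proj₁) (b≢c ∘ cong proj₁)
    (lift-onCommonShortestPath G H f fa≡ha fb≡hb fc≡hc onPath)
  where
  _≟_ : DecidableEquality (V G)
  _≟_ = finite⇒decidableEquality G finG

  f : V G → V H
  f = update _≟_ a ha (update _≟_ b hb (const hc))

  fa≡ha : f a ≡ ha
  fa≡ha = update-≡ _≟_ a ha _

  fb≡hb : f b ≡ hb
  fb≡hb = trans (update-≢ _≟_ ha _ (≢-sym a≢b)) (update-≡ _≟_ b hb _)

  fc≡hc : f c ≡ hc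
  fc≡hc = trans (update-≢ _≟_ ha _ (≢-sym a≢c)) (update-≢ _≟_ hb _ (≢-sym b≢c))
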